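{- Let $n\ge1$, $t\in\mathbb Z_{\ge0}$ and $\mathbf N=(t,t,\dots,t,-nt)\in\mathbb Z^{n+1}$. Then \[ (t+1)^{\binom n2}\ge K_n(\mathbf N)\ge\prod_{i=1}^{n-1}(it+1). \]
   Context: $K_n(\mathbf N)$ denotes the number of integer vectors $(f_{ij})_{0\le i<j\le n}$ with $f_{ij}\ge0$ and $\sum_{j>i}f_{ij}-\sum_{k<i}f_{ki}=N_i$ for all $i\in\{0,\dots,n\}$. -}

module Defs where

open import Data.Nat using (ℕ; zero; suc; _+_; _*_)
open import Data.Integer as ℤ using (ℤ; +_; -_)
open import Data.Fin using (Fin; zero; suc; _<?_; _≟_; fromℕ)
open import Data.Vec using (Vec; lookup)
open import Data.List using (List; length; map; drop; upTo)
open import Data.Nat.ListAction using (product)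
open import Data.List.Relation.Unary.Unique.Propositional using (Unique)
open import Data.List.Membership.Propositional using (_∈_)
open import Data.Product using (Σ; _×_)
open import Data.Bool using (if_then_else_; true; false)
open import Relation.Nullary.Decidable using (⌊_⌋; does)
open import Relation.Binary.PropositionalEquality using (_≡_)
open import Function.Bundles using (_⇔_)

sumℤ : ∀ {m} → (Fin m → ℤ) → ℤ
sumℤ {zero}  g = + 0
sumℤ {suc m} g = g zero ℤ.+ sumℤ (λ j → g (suc j))

-- A candidate flow on vertices 0..n is an (n+1)×(n+1) matrix of naturals;
-- entry (i , j) stores f_ij.  Only entries with i < j are meaningful, so
-- entries with i ≥ j are required to be 0 (so that matrices correspond
-- bijectively to vectors (f_ij)_{0 ≤ i < j ≤ n} of nonnegative integers).
Mat : ℕ → Set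
Mat m = Vec (Vec ℕ m) m

entry : ∀ {m} → Mat m → Fin m → Fin m → ℕ
entry f i j = lookup (lookup f i) j

outflow : ∀ {m} → Mat m → Fin m → ℤ
outflow f i = sumℤ (λ j → if does (i <? j) then + entry f i j else + 0)

inflow : ∀ {m} → Mat m → Fin m → ℤ
inflow f i = sumℤ (λ k → if does (k <? i) then + entry f k i else + 0)

IsFlow : ∀ n → (Fin (suc n) → ℤ) → Mat (suc n) → Set
IsFlow n N f =
  (∀ i j → does (i <? j) ≡ false → entry f i j ≡ 0) ×
  (∀ i → outflow f i ℤ.- inflow f i ≡ N i)

HasCount : ∀ {A : Set} → (A → Set) → ℕ → Set
HasCount {A} P k =
  Σ (List A) (λ xs → Unique xs × (∀ a → (a ∈ xs) ⇔ P a) × length xs ≡ k)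

KnIs : ∀ n → (Fin (suc n) → ℤ) → ℕ → Set
KnIs n N k = HasCount (IsFlow n N) k

Nvec : ∀ n → ℕ → Fin (suc n) → ℤ
Nvec n t i = if does (i ≟ fromℕ n) then - (+ (n * t)) else + t

lowerProd : ℕ → ℕ → ℕ
lowerProd n t = product (map (λ i → i * t + 1) (drop 1 (upTo n)))

-- Removing vertex 0 of a flow leaves a flow on the remaining vertices whose supplies have grown by
-- the row (f₀₁, …, f₀ₙ), a composition of N₀; this enumerates the flows. Merging the last two
-- vertices instead, every flow into the merged sink splits in f + 1 ways and the edge between them
-- is then forced, so K_{m+1}(t, …, t, −(m+1)t) is the sum over flows for (t, …, t, −mt) of
-- ∏ᵢ (fᵢₘ + 1). These m inflows total mt, hence 1 + mt ≤ ∏ᵢ (fᵢₘ + 1) ≤ (t + 1)^m by the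
-- arithmetic–geometric mean inequality, and both bounds follow by induction on m since
-- C(m+1, 2) = m + C(m, 2).

module Submission where

open import Defs
open import Data.Nat using (ℕ; zero; suc; _+_; _*_; _^_; _≤_; _<_; _≤?_; _<?_; z≤n; z<s)
open import Data.Nat.Properties
open import Data.Nat.ListAction using (sum; product)
open import Data.Nat.ListAction.Properties using (sum-++; product-++; sum-↭; product-↭)
open import Data.Nat.Combinatorics using (_C_; nC1≡n; nCk+nC[k+1]≡[n+1]C[k+1])
open import Data.List as List using (List; []; _∷_; _++_; map; concatMap; length; applyUpTo)
open import Data.List.Properties using (map-++; map-cong; map-∘; length-map; length-++; applyUpTo-∷ʳ)
open import Data.List.Membership.Propositional using (_∈_; find; lose)
open import Data.List.Membership.Propositional.Properties
  using (∈-map⁺; ∈-map⁻; ∈-concatMap⁺; ∈-concatMap⁻; ∈-∃++)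
open import Data.List.Relation.Unary.Any using (Any; here; there; any?)
open import Data.List.Relation.Unary.All as All using (All; []; _∷_)
open import Data.List.Relation.Unary.All.Properties using (¬Any⇒All¬)
open import Data.List.Relation.Unary.AllPairs using ([]; _∷_)
open import Data.List.Relation.Unary.Unique.Propositional using (Unique)
open import Data.List.Relation.Unary.Unique.Propositional.Properties using (map⁺; ++⁺)
open import Data.List.Relation.Binary.Permutation.Propositional using (_↭_)
open import Data.List.Relation.Binary.Permutation.Propositional.Properties using (shift; ↭-length)
open import Data.Vec as Vec using (Vec; []; _∷_; _∷ʳ_; zipWith; lookup; replicate)
open import Data.Vec.Properties using (length-toList; lookup-map; ∷-injective)
open import Data.Product using (Σ; ∃; _×_; _,_; proj₁; proj₂; map₁)
open import Function.Bundles using (mk⇔)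
open import Data.Empty using (⊥-elim)
open import Relation.Nullary using (yes; no)
open import Relation.Binary.PropositionalEquality
open import Data.Nat.Tactic.RingSolver using (solve-∀)
open import Algebra.Properties.CommutativeSemigroup +-commutativeSemigroup using (interchange; x∙yz≈y∙xz; x∙yz≈y∙zx)

private
  variable
    A B : Set

sum-map-cong : (f g : A → ℕ) (xs : List A) → (∀ x → f x ≡ g x) → sum (map f xs) ≡ sum (map g xs)
sum-map-cong f g xs f≗g = cong sum (map-cong f≗g xs)

sum-map-mono : (f g : A → ℕ) (xs : List A) → (∀ x → x ∈ xs → f x ≤ g x) → sum (map f xs) ≤ sum (map g xs)
sum-map-mono f g []       f≤g = z≤n
sum-map-mono f g (x ∷ xs) f≤g = +-mono-≤ (f≤g x (here refl)) (sum-map-mono f g xs (λ y y∈ → f≤g y (there y∈)))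

sum-map-const : (k : ℕ) (xs : List A) → sum (map (λ _ → k) xs) ≡ length xs * k
sum-map-const k []       = refl
sum-map-const k (x ∷ xs) = cong (k +_) (sum-map-const k xs)

sum-map-*ˡ : (k : ℕ) (f : A → ℕ) (xs : List A) → sum (map (λ x → k * f x) xs) ≡ k * sum (map f xs)
sum-map-*ˡ k f []       = sym (*-zeroʳ k)
sum-map-*ˡ k f (x ∷ xs) = trans (cong (k * f x +_) (sum-map-*ˡ k f xs)) (sym (*-distribˡ-+ k (f x) _))

sum-map-+ : (f g : A → ℕ) (xs : List A) → sum (map (λ x → f x + g x) xs) ≡ sum (map f xs) + sum (map g xs)
sum-map-+ f g []       = refl
sum-map-+ f g (x ∷ xs) = trans (cong (f x + g x +_) (sum-map-+ f g xs)) (interchange (f x) (g x) _ _)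

sum-map-comm : (f : A → B → ℕ) (xs : List A) (ys : List B) →
  sum (map (λ x → sum (map (f x) ys)) xs) ≡ sum (map (λ y → sum (map (λ x → f x y) xs)) ys)
sum-map-comm f []       ys = sym (trans (sum-map-const 0 ys) (*-zeroʳ (length ys)))
sum-map-comm f (x ∷ xs) ys = trans (cong (sum (map (f x) ys) +_) (sum-map-comm f xs ys))
  (sym (sum-map-+ (f x) (λ y → sum (map (λ x → f x y) xs)) ys))

sum-map-concatMap : (f : B → ℕ) (g : A → List B) (xs : List A) →
  sum (map f (concatMap g xs)) ≡ sum (map (λ x → sum (map f (g x))) xs)
sum-map-concatMap f g []       = refl
sum-map-concatMap f g (x ∷ xs) = begin
  sum (map f (g x ++ concatMap g xs))               ≡⟨ cong sum (map-++ f (g x) _) ⟩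
  sum (map f (g x) ++ map f (concatMap g xs))       ≡⟨ sum-++ (map f (g x)) _ ⟩
  sum (map f (g x)) + sum (map f (concatMap g xs))  ≡⟨ cong (_ +_) (sum-map-concatMap f g xs) ⟩
  sum (map f (g x)) + sum (map (λ x → sum (map f (g x))) xs) ∎
  where open ≡-Reasoning

length-concatMap : (g : A → List B) (xs : List A) → length (concatMap g xs) ≡ sum (map (λ x → length (g x)) xs)
length-concatMap g []       = refl
length-concatMap g (x ∷ xs) = trans (length-++ (g x)) (cong (length (g x) +_) (length-concatMap g xs))

concatMap-unique : (g : A → List B) {xs : List A} → Unique xs → (∀ x → Unique (g x)) →
  (∀ {x y v} → v ∈ g x → v ∈ g y → x ≡ y) → Unique (concatMap g xs)
concatMap-unique g []             g! disjoint = []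
concatMap-unique g (x∉xs ∷ xs!) g! disjoint =
  ++⁺ (g! _) (concatMap-unique g xs! g! disjoint) λ (v∈gx , v∈rest) →
    let y , y∈xs , v∈gy = find (∈-concatMap⁻ g v∈rest) in All.lookup x∉xs y∈xs (disjoint v∈gx v∈gy)

-- Arithmetic and geometric means

∈⇒↭∷ : ∀ {y : A} {xs} → y ∈ xs → ∃ λ rest → xs ↭ y ∷ rest
∈⇒↭∷ y∈xs with ys , zs , refl ← ∈-∃++ y∈xs = ys ++ zs , shift _ ys zs

product≤^-all : ∀ T {xs} → All (_≤ T) xs → product xs ≤ T ^ length xs
product≤^-all T []         = ≤-refl
product≤^-all T (x≤T ∷ xs) = *-mono-≤ x≤T (product≤^-all T xs)

*suc≤sum-all : ∀ T {xs} → All (T <_) xs → length xs * suc T ≤ sum xs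
*suc≤sum-all T []         = z≤n
*suc≤sum-all T (T<x ∷ xs) = +-mono-≤ T<x (*suc≤sum-all T xs)

-- Replacing the pair (T + d, z) by (T, z + d) keeps the sum and does not decrease the product.
smoothing : ∀ {T z} d P → z ≤ T → (T + d) * (z * P) ≤ T * ((z + d) * P)
smoothing {T} {z} d P z≤T = begin
  (T + d) * (z * P)    ≡⟨ *-assoc (T + d) z P ⟨
  (T + d) * z * P      ≡⟨ cong (_* P) (*-distribʳ-+ z T d) ⟩
  (T * z + d * z) * P  ≤⟨ *-monoˡ-≤ P (+-monoʳ-≤ (T * z) (*-monoʳ-≤ d z≤T)) ⟩
  (T * z + d * T) * P  ≡⟨ cong (λ x → (T * z + x) * P) (*-comm d T) ⟩
  (T * z + T * d) * P  ≡⟨ cong (_* P) (*-distribˡ-+ T z d) ⟨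
  T * (z + d) * P      ≡⟨ *-assoc T (z + d) P ⟩
  T * ((z + d) * P)    ∎
  where open ≤-Reasoning

sum<⇒∃≤ : ∀ T (xs : List ℕ) → sum xs < length xs * suc T → Any (_≤ T) xs
sum<⇒∃≤ T xs sum< with any? (_≤? T) xs
... | yes small = small
... | no ¬small = ⊥-elim (<⇒≱ sum< (*suc≤sum-all T (All.map ≰⇒> (¬Any⇒All¬ xs ¬small))))

-- The arithmetic–geometric mean inequality over ℕ, by repeated smoothing.
product≤^ : ∀ T (xs : List ℕ) → sum xs ≤ length xs * T → product xs ≤ T ^ length xs
product≤^ T xs = bounded (length xs) xs refl
  where
  bounded : ∀ n xs → length xs ≡ n → sum xs ≤ n * T → product xs ≤ T ^ n
  bounded zero    []      _ _ = ≤-refl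
  bounded (suc n) xs len sum≤ with any? (T <?_) xs
  ... | no ¬big = subst (λ k → product xs ≤ T ^ k) len (product≤^-all T (All.map ≮⇒≥ (¬Any⇒All¬ xs ¬big)))
  ... | yes big with find big
  ... | y , y∈xs , T<y with d , refl ← m≤n⇒∃[o]m+o≡n (<⇒≤ T<y) with rest , xs↭ ← ∈⇒↭∷ y∈xs =
    smoothed (find (sum<⇒∃≤ T rest sum-rest<))
    where
    length-rest : length rest ≡ n
    length-rest = suc-injective (trans (sym (↭-length xs↭)) len)
    sum-rest< : sum rest < length rest * suc T
    sum-rest< = begin-strict
      sum rest          <⟨ +-cancelˡ-< T (sum rest) (n * T) (begin-strict
                             T + sum rest  <⟨ +-monoˡ-< (sum rest) T<y ⟩
                             y + sum rest  ≡⟨ sum-↭ xs↭ ⟨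
                             sum xs        ≤⟨ sum≤ ⟩
                             T + n * T     ∎) ⟩
      n * T             ≤⟨ *-monoʳ-≤ n (n≤1+n T) ⟩
      n * suc T         ≡⟨ cong (_* suc T) length-rest ⟨
      length rest * suc T ∎
      where open ≤-Reasoning
    smoothed : (∃ λ z → z ∈ rest × z ≤ T) → product xs ≤ T ^ suc n
    smoothed (z , z∈rest , z≤T) with rest′ , rest↭ ← ∈⇒↭∷ z∈rest = begin
      product xs                         ≡⟨ trans (product-↭ xs↭) (cong (y *_) (product-↭ rest↭)) ⟩
      (T + d) * (z * product rest′)      ≤⟨ smoothing d (product rest′) z≤T ⟩
      T * ((z + d) * product rest′)      ≤⟨ *-monoʳ-≤ T (bounded n ((z + d) ∷ rest′) length-smoothed smoothed-sum≤) ⟩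
      T * T ^ n                          ∎
      where
      open ≤-Reasoning
      length-smoothed : suc (length rest′) ≡ n
      length-smoothed = trans (sym (↭-length rest↭)) length-rest
      smoothed-sum≤ : z + d + sum rest′ ≤ n * T
      smoothed-sum≤ = +-cancelˡ-≤ T _ _ (begin
        T + (z + d + sum rest′)          ≡⟨ regroup T z d (sum rest′) ⟩
        (T + d) + (z + sum rest′)        ≡⟨ trans (sum-↭ xs↭) (cong (y +_) (sum-↭ rest↭)) ⟨
        sum xs                           ≤⟨ sum≤ ⟩
        suc n * T                        ∎)
        where
        regroup : ∀ T z d s → T + (z + d + s) ≡ (T + d) + (z + s)
        regroup = solve-∀

-- Compositions

splits : ℕ → List (ℕ × ℕ)
splits zero    = (0 , 0) ∷ []
splits (suc a) = (0 , suc a) ∷ map (map₁ suc) (splits a)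

length-splits : ∀ a → length (splits a) ≡ suc a
length-splits zero    = refl
length-splits (suc a) = cong suc (trans (length-map (map₁ suc) (splits a)) (length-splits a))

∈-splits⁻ : ∀ a {p q} → (p , q) ∈ splits a → p + q ≡ a
∈-splits⁻ zero    (here refl) = refl
∈-splits⁻ (suc a) (here refl) = refl
∈-splits⁻ (suc a) (there s∈) with ∈-map⁻ (map₁ suc) s∈
... | _ , s∈′ , refl = cong suc (∈-splits⁻ a s∈′)

∈-splits⁺ : ∀ {a} p q → p + q ≡ a → (p , q) ∈ splits a
∈-splits⁺ zero    zero refl = here refl
∈-splits⁺ zero    (suc q) refl = here refl
∈-splits⁺ (suc p) q refl = there (∈-map⁺ (map₁ suc) (∈-splits⁺ p q refl))

splits-unique : ∀ a → Unique (splits a)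
splits-unique zero    = [] ∷ []
splits-unique (suc a) = All.tabulate head∉ ∷ map⁺ map₁-suc-injective (splits-unique a)
  where
  head∉ : ∀ {s} → s ∈ map (map₁ suc) (splits a) → (0 , suc a) ≢ s
  head∉ s∈ refl with ∈-map⁻ (map₁ suc) s∈
  ... | _ , _ , ()
  map₁-suc-injective : ∀ {s s′ : ℕ × ℕ} → map₁ suc s ≡ map₁ suc s′ → s ≡ s′
  map₁-suc-injective {_ , _} {_ , _} refl = refl

compositions : ℕ → (k : ℕ) → List (Vec ℕ (suc k))
compositions a zero    = (a ∷ []) ∷ []
compositions a (suc k) = concatMap (λ s → map (proj₁ s ∷_) (compositions (proj₂ s) k)) (splits a)

∈-compositions⁻ : ∀ a k {c} → c ∈ compositions a k → Vec.sum c ≡ a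
∈-compositions⁻ a zero    (here refl) = +-identityʳ a
∈-compositions⁻ a (suc k) c∈ with find (∈-concatMap⁻ _ {xs = splits a} c∈)
... | (p , q) , s∈ , c∈′ with ∈-map⁻ (p ∷_) c∈′
... | c′ , c′∈ , refl = trans (cong (p +_) (∈-compositions⁻ q k c′∈)) (∈-splits⁻ a s∈)

∈-compositions⁺ : ∀ k (c : Vec ℕ (suc k)) → c ∈ compositions (Vec.sum c) k
∈-compositions⁺ zero    (x ∷ []) = here (cong (_∷ []) (sym (+-identityʳ x)))
∈-compositions⁺ (suc k) (x ∷ c)  = ∈-concatMap⁺ _ (lose (∈-splits⁺ x (Vec.sum c) refl) (∈-map⁺ (x ∷_) (∈-compositions⁺ k c)))

compositions-unique : ∀ a k → Unique (compositions a k)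
compositions-unique a zero    = [] ∷ []
compositions-unique a (suc k) =
  concatMap-unique _ (splits-unique a) (λ s → map⁺ (λ { refl → refl }) (compositions-unique (proj₂ s) k)) disjoint
  where
  disjoint : ∀ {s s′ v} → v ∈ map (proj₁ s ∷_) (compositions (proj₂ s) k) →
             v ∈ map (proj₁ s′ ∷_) (compositions (proj₂ s′) k) → s ≡ s′
  disjoint {_ , q} {_ , q′} v∈ v∈′ with ∈-map⁻ _ v∈ | ∈-map⁻ _ v∈′
  ... | c , c∈ , refl | c′ , c′∈ , refl = cong (_ ,_) (trans (sym (∈-compositions⁻ q k c∈)) (∈-compositions⁻ q′ k c′∈))

sum-init+last : ∀ {m} (c : Vec ℕ (suc m)) → Vec.sum (Vec.init c) + Vec.last c ≡ Vec.sum c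
sum-init+last (x ∷ [])    = +-comm 0 x
sum-init+last (x ∷ y ∷ c) = trans (+-assoc x _ _) (cong (x +_) (sum-init+last (y ∷ c)))

sum-zipWith-+ : ∀ {m} (a b : Vec ℕ m) → Vec.sum (zipWith _+_ a b) ≡ Vec.sum a + Vec.sum b
sum-zipWith-+ []      []      = refl
sum-zipWith-+ (x ∷ a) (y ∷ b) = trans (cong (x + y +_) (sum-zipWith-+ a b)) (interchange x y _ _)

zipWith-+-∷ʳ : ∀ {m} (as : Vec ℕ m) b (c : Vec ℕ (suc m)) →
  zipWith _+_ (as ∷ʳ b) c ≡ zipWith _+_ as (Vec.init c) ∷ʳ (b + Vec.last c)
zipWith-+-∷ʳ []       b (x ∷ [])    = refl
zipWith-+-∷ʳ (a ∷ as) b (x ∷ y ∷ c) = cong (a + x ∷_) (zipWith-+-∷ʳ as b (y ∷ c))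

replicate-suc : ∀ m (x : A) → replicate (suc m) x ≡ replicate m x ∷ʳ x
replicate-suc zero    x = refl
replicate-suc (suc m) x = cong (x ∷_) (replicate-suc m x)

sum-replicate : ∀ m t → Vec.sum (replicate m t) ≡ m * t
sum-replicate zero    t = refl
sum-replicate (suc m) t = cong (t +_) (sum-replicate m t)

-- Weighted flow counts

-- weightedCount a F is the sum of F (f₀ₙ, …, f₍ₙ₋₁₎ₙ) over the flows f with N = (a₀, …, aₙ₋₁, −Σ a):
-- the row c of vertex 0 is a composition of a₀, its last entry enters the sink and the others
-- are added to the supplies of vertices 1, …, n − 1.
weightedCount : ∀ {n} → Vec ℕ n → (Vec ℕ n → ℕ) → ℕ
weightedCount []                F = F []
weightedCount {suc n} (a ∷ as) F =
  sum (map (λ c → weightedCount (zipWith _+_ as (Vec.init c)) (λ v → F (Vec.last c ∷ v))) (compositions a n))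

weightedCount-mono : ∀ {n} (a : Vec ℕ n) F G → (∀ v → Vec.sum v ≡ Vec.sum a → F v ≤ G v) →
  weightedCount a F ≤ weightedCount a G
weightedCount-mono []                F G F≤G = F≤G [] refl
weightedCount-mono {suc n} (a ∷ as) F G F≤G = sum-map-mono _ _ (compositions a n) λ c c∈ →
  weightedCount-mono (zipWith _+_ as (Vec.init c)) _ _ λ v v-total → F≤G (Vec.last c ∷ v) (begin
    Vec.last c + Vec.sum v                                     ≡⟨ cong (Vec.last c +_) (trans v-total (sum-zipWith-+ as (Vec.init c))) ⟩
    Vec.last c + (Vec.sum as + Vec.sum (Vec.init c))           ≡⟨ x∙yz≈y∙zx (Vec.last c) (Vec.sum as) _ ⟩
    Vec.sum as + (Vec.sum (Vec.init c) + Vec.last c)           ≡⟨ cong (Vec.sum as +_) (trans (sum-init+last c) (∈-compositions⁻ a n c∈)) ⟩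
    Vec.sum as + a                                             ≡⟨ +-comm (Vec.sum as) a ⟩
    a + Vec.sum as ∎)
  where open ≡-Reasoning

weightedCount-const : ∀ {n} (a : Vec ℕ n) k → weightedCount a (λ _ → k) ≡ k * weightedCount a (λ _ → 1)
weightedCount-const []                k = sym (*-identityʳ k)
weightedCount-const {suc n} (a ∷ as) k =
  trans (sum-map-cong _ _ (compositions a n) λ c → weightedCount-const (zipWith _+_ as (Vec.init c)) k)
        (sum-map-*ˡ k _ (compositions a n))

weightedCount-sum : ∀ {n} (a : Vec ℕ n) (xs : List B) (F : B → Vec ℕ n → ℕ) →
  weightedCount a (λ v → sum (map (λ x → F x v) xs)) ≡ sum (map (λ x → weightedCount a (F x)) xs)
weightedCount-sum []                xs F = refl
weightedCount-sum {n = suc n} (a ∷ as) xs F =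
  trans (sum-map-cong _ _ (compositions a n) λ c → weightedCount-sum (zipWith _+_ as (Vec.init c)) xs _)
        (sum-map-comm (λ c x → weightedCount (zipWith _+_ as (Vec.init c)) (λ v → F x (Vec.last c ∷ v))) (compositions a n) xs)

splitSum : ∀ {m} → (Vec ℕ m → ℕ) → Vec ℕ m → ℕ
splitSum G []       = G []
splitSum G (u ∷ us) = sum (map (λ s → splitSum (λ v → G (proj₂ s ∷ v)) us) (splits u))

-- A composition into k + 2 parts is a composition into k + 1 parts whose last part is split in two.
sum-compositions-suc : ∀ k a (Φ : Vec ℕ k → ℕ → ℕ) →
  sum (map (λ c → Φ (Vec.init (Vec.init c)) (Vec.last c)) (compositions a (suc k))) ≡
  sum (map (λ d → sum (map (λ s → Φ (Vec.init d) (proj₂ s)) (splits (Vec.last d)))) (compositions a k))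
sum-compositions-suc zero a Φ = begin
  sum (map (λ c → Φ (Vec.init (Vec.init c)) (Vec.last c)) (compositions a 1))  ≡⟨ sum-map-concatMap _ _ (splits a) ⟩
  sum (map (λ s → Φ [] (proj₂ s) + 0) (splits a))          ≡⟨ sum-map-cong _ _ (splits a) (λ s → +-identityʳ _) ⟩
  sum (map (λ s → Φ [] (proj₂ s)) (splits a))              ≡⟨ +-identityʳ _ ⟨
  sum (map (λ s → Φ [] (proj₂ s)) (splits a)) + 0          ∎
  where open ≡-Reasoning
sum-compositions-suc (suc k) a Φ = begin
  sum (map (λ c → Φ (Vec.init (Vec.init c)) (Vec.last c)) (compositions a (suc (suc k))))
    ≡⟨ sum-map-concatMap _ _ (splits a) ⟩
  sum (map (λ s → sum (map (λ c → Φ (Vec.init (Vec.init c)) (Vec.last c)) (map (proj₁ s ∷_) (compositions (proj₂ s) (suc k))))) (splits a))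
    ≡⟨ sum-map-cong _ _ (splits a) (λ s →
         trans (cong sum (sym (map-∘ (compositions (proj₂ s) (suc k)))))
        (trans (sum-compositions-suc k (proj₂ s) (λ e → Φ (proj₁ s ∷ e)))
               (cong sum (map-∘ (compositions (proj₂ s) k))))) ⟩
  sum (map (λ s → sum (map (λ d → sum (map (λ s′ → Φ (Vec.init d) (proj₂ s′)) (splits (Vec.last d)))) (map (proj₁ s ∷_) (compositions (proj₂ s) k)))) (splits a))
    ≡⟨ sum-map-concatMap _ _ (splits a) ⟨
  sum (map (λ d → sum (map (λ s → Φ (Vec.init d) (proj₂ s)) (splits (Vec.last d)))) (compositions a (suc k))) ∎
  where open ≡-Reasoning

-- Merging the last two vertices: each edge i → n − 1 together with i → n becomes one edge whose flow
-- is split between them, and the flow out of n − 1 is then forced.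
weightedCount-∷ʳ : ∀ {m} (as : Vec ℕ m) b (G : Vec ℕ m → ℕ) →
  weightedCount (as ∷ʳ b) (λ v → G (Vec.init v)) ≡ weightedCount as (splitSum G)
weightedCount-∷ʳ []                b G = +-identityʳ (G [])
weightedCount-∷ʳ {suc m} (a ∷ as) b G = begin
  sum (map (λ c → weightedCount (zipWith _+_ (as ∷ʳ b) (Vec.init c)) (λ v → G (Vec.init (Vec.last c ∷ v)))) (compositions a (suc m)))
    ≡⟨ sum-map-cong _ _ (compositions a (suc m)) merge-tail ⟩
  sum (map (λ c → Φ (Vec.init (Vec.init c)) (Vec.last c)) (compositions a (suc m)))
    ≡⟨ sum-compositions-suc m a Φ ⟩
  sum (map (λ d → sum (map (λ s → Φ (Vec.init d) (proj₂ s)) (splits (Vec.last d)))) (compositions a m))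
    ≡⟨ sum-map-cong _ _ (compositions a m) (λ d →
         weightedCount-sum (zipWith _+_ as (Vec.init d)) (splits (Vec.last d)) (λ s → splitSum (λ w → G (proj₂ s ∷ w)))) ⟨
  weightedCount (a ∷ as) (splitSum G) ∎
  where
  open ≡-Reasoning
  Φ : Vec ℕ m → ℕ → ℕ
  Φ e q = weightedCount (zipWith _+_ as e) (splitSum (λ w → G (q ∷ w)))
  merge-tail : ∀ c → weightedCount (zipWith _+_ (as ∷ʳ b) (Vec.init c)) (λ v → G (Vec.init (Vec.last c ∷ v)))
                   ≡ Φ (Vec.init (Vec.init c)) (Vec.last c)
  merge-tail c = begin
    weightedCount (zipWith _+_ (as ∷ʳ b) (Vec.init c)) (λ v → G (Vec.last c ∷ Vec.init v))
      ≡⟨ cong (λ x → weightedCount x (λ v → G (Vec.last c ∷ Vec.init v))) (zipWith-+-∷ʳ as b (Vec.init c)) ⟩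
    weightedCount (zipWith _+_ as (Vec.init (Vec.init c)) ∷ʳ (b + Vec.last (Vec.init c))) (λ v → G (Vec.last c ∷ Vec.init v))
      ≡⟨ weightedCount-∷ʳ (zipWith _+_ as (Vec.init (Vec.init c))) _ (λ w → G (Vec.last c ∷ w)) ⟩
    Φ (Vec.init (Vec.init c)) (Vec.last c) ∎

splitSum-one-∷ : ∀ {m} x (u : Vec ℕ m) → splitSum (λ _ → 1) (x ∷ u) ≡ suc x * splitSum (λ _ → 1) u
splitSum-one-∷ x u = trans (sum-map-const _ (splits x)) (cong (_* splitSum (λ _ → 1) u) (length-splits x))

splitSum-one : ∀ {m} (u : Vec ℕ m) → splitSum (λ _ → 1) u ≡ product (map suc (Vec.toList u))
splitSum-one []      = refl
splitSum-one (x ∷ u) = trans (splitSum-one-∷ x u) (cong (suc x *_) (splitSum-one u))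

sum-map-suc-toList : ∀ {m} (u : Vec ℕ m) → sum (map suc (Vec.toList u)) ≡ m + Vec.sum u
sum-map-suc-toList []                = refl
sum-map-suc-toList {suc m} (x ∷ u) = cong suc (trans (cong (x +_) (sum-map-suc-toList u)) (x∙yz≈y∙xz x m _))

splitSum-one-≤ : ∀ {m} t (u : Vec ℕ m) → Vec.sum u ≡ m * t → splitSum (λ _ → 1) u ≤ suc t ^ m
splitSum-one-≤ {m} t u total = begin
  splitSum (λ _ → 1) u   ≡⟨ splitSum-one u ⟩
  product sucs           ≤⟨ product≤^ (suc t) sucs (≤-reflexive sum≡) ⟩
  suc t ^ length sucs    ≡⟨ cong (suc t ^_) length-sucs ⟩
  suc t ^ m              ∎
  where
  open ≤-Reasoning
  sucs = map suc (Vec.toList u)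
  length-sucs : length sucs ≡ m
  length-sucs = trans (length-map suc (Vec.toList u)) (length-toList u)
  sum≡ : sum sucs ≡ length sucs * suc t
  sum≡ = begin-equality
    sum sucs               ≡⟨ sum-map-suc-toList u ⟩
    m + Vec.sum u          ≡⟨ cong (m +_) total ⟩
    m + m * t              ≡⟨ *-suc m t ⟨
    m * suc t              ≡⟨ cong (_* suc t) length-sucs ⟨
    length sucs * suc t    ∎

splitSum-one-≥ : ∀ {m} (u : Vec ℕ m) → suc (Vec.sum u) ≤ splitSum (λ _ → 1) u
splitSum-one-≥ []      = ≤-refl
splitSum-one-≥ (x ∷ u) = begin
  suc (x + Vec.sum u)         ≡⟨ cong suc (+-comm x (Vec.sum u)) ⟩
  suc (Vec.sum u) + x         ≤⟨ +-monoʳ-≤ (suc (Vec.sum u)) (m≤m*n x (suc (Vec.sum u))) ⟩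
  suc x * suc (Vec.sum u)     ≤⟨ *-monoʳ-≤ (suc x) (splitSum-one-≥ u) ⟩
  suc x * splitSum (λ _ → 1) u ≡⟨ splitSum-one-∷ x u ⟨
  splitSum (λ _ → 1) (x ∷ u)  ∎
  where open ≤-Reasoning

K : ℕ → ℕ → ℕ
K n t = weightedCount (replicate n t) (λ _ → 1)

K-suc : ∀ m t → K (suc m) t ≡ weightedCount (replicate m t) (splitSum (λ _ → 1))
K-suc m t = trans (cong (λ a → weightedCount a (λ _ → 1)) (replicate-suc m t)) (weightedCount-∷ʳ (replicate m t) t (λ _ → 1))

suc[m]C2 : ∀ m → suc m C 2 ≡ m + m C 2
suc[m]C2 m = trans (sym (nCk+nC[k+1]≡[n+1]C[k+1] m 1)) (cong (_+ m C 2) (nC1≡n m))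

K-≤ : ∀ m t → K m t ≤ suc t ^ (m C 2)
K-≤ zero    t = ≤-refl
K-≤ (suc m) t = begin
  K (suc m) t                                          ≡⟨ K-suc m t ⟩
  weightedCount (replicate m t) (splitSum (λ _ → 1))   ≤⟨ weightedCount-mono (replicate m t) _ _ (λ u total →
                                                            splitSum-one-≤ t u (trans total (sum-replicate m t))) ⟩
  weightedCount (replicate m t) (λ _ → suc t ^ m)      ≡⟨ weightedCount-const (replicate m t) (suc t ^ m) ⟩
  suc t ^ m * K m t                                    ≤⟨ *-monoʳ-≤ (suc t ^ m) (K-≤ m t) ⟩
  suc t ^ m * suc t ^ (m C 2)                          ≡⟨ ^-distribˡ-+-* (suc t) m (m C 2) ⟨
  suc t ^ (m + m C 2)                                  ≡⟨ cong (suc t ^_) (suc[m]C2 m) ⟨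
  suc t ^ (suc m C 2)                                  ∎
  where open ≤-Reasoning

lowerProd-suc : ∀ m t → lowerProd (suc m) t ≡ lowerProd m t * (m * t + 1)
lowerProd-suc zero    t = refl
lowerProd-suc (suc m) t = begin
  product (map g (applyUpTo suc (suc m)))              ≡⟨ cong (λ xs → product (map g xs)) (applyUpTo-∷ʳ suc m) ⟨
  product (map g (applyUpTo suc m List.∷ʳ suc m))      ≡⟨ cong product (map-++ g (applyUpTo suc m) _) ⟩
  product (map g (applyUpTo suc m) ++ g (suc m) ∷ [])  ≡⟨ product-++ (map g (applyUpTo suc m)) _ ⟩
  lowerProd (suc m) t * (g (suc m) * 1)                ≡⟨ cong (lowerProd (suc m) t *_) (*-identityʳ (g (suc m))) ⟩
  lowerProd (suc m) t * g (suc m)                      ∎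
  where
  open ≡-Reasoning
  g : ℕ → ℕ
  g i = i * t + 1

K-≥ : ∀ m t → lowerProd m t ≤ K m t
K-≥ zero    t = ≤-refl
K-≥ (suc m) t = begin
  lowerProd (suc m) t                                  ≡⟨ lowerProd-suc m t ⟩
  lowerProd m t * (m * t + 1)                          ≤⟨ *-monoˡ-≤ (m * t + 1) (K-≥ m t) ⟩
  K m t * (m * t + 1)                                  ≡⟨ trans (*-comm (K m t) _) (cong (_* K m t) (+-comm (m * t) 1)) ⟩
  suc (m * t) * K m t                                  ≡⟨ weightedCount-const (replicate m t) (suc (m * t)) ⟨
  weightedCount (replicate m t) (λ _ → suc (m * t))    ≤⟨ weightedCount-mono (replicate m t) _ _ (λ u total →
                                                            subst (λ s → suc s ≤ splitSum (λ _ → 1) u) (trans total (sum-replicate m t)) (splitSum-one-≥ u)) ⟩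
  weightedCount (replicate m t) (splitSum (λ _ → 1))   ≡⟨ K-suc m t ⟨
  K (suc m) t                                          ∎
  where open ≤-Reasoning

-- Flow matrices

-- Imported only here: ℤ's +_ would make the ℕ sections (m +_) above ambiguous.
open import Data.Integer as ℤ using (ℤ; +_; -_) renaming (_+_ to _+ℤ_; _-_ to _-ℤ_)
import Data.Integer.Properties as ℤ
open import Data.Integer.Tactic.RingSolver using () renaming (solve-∀ to solve-∀ℤ)
open import Data.Fin as Fin using (Fin; zero; suc)
open import Data.Bool using (if_then_else_; false)
open import Relation.Nullary.Decidable using (does)
open import Algebra.Bundles using (AbelianGroup)
open import Algebra.Properties.Group (AbelianGroup.group ℤ.+-0-abelianGroup) using (∙-cancelʳ)

sumℤ-cong : ∀ {m} (g h : Fin m → ℤ) → (∀ j → g j ≡ h j) → sumℤ g ≡ sumℤ h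
sumℤ-cong {zero}  g h g≗h = refl
sumℤ-cong {suc m} g h g≗h = cong₂ _+ℤ_ (g≗h zero) (sumℤ-cong (λ j → g (suc j)) (λ j → h (suc j)) (λ j → g≗h (suc j)))

sumℤ-zero : ∀ m → sumℤ {m} (λ _ → + 0) ≡ + 0
sumℤ-zero zero    = refl
sumℤ-zero (suc m) = trans (ℤ.+-identityˡ _) (sumℤ-zero m)

sumℤ-lookup : ∀ {m} (c : Vec ℕ m) → sumℤ (λ j → + lookup c j) ≡ + Vec.sum c
sumℤ-lookup []      = refl
sumℤ-lookup (x ∷ c) = trans (cong (+ x +ℤ_) (sumℤ-lookup c)) (sym (ℤ.pos-+ x (Vec.sum c)))

IsStrictlyUpper : ∀ {m} → Mat m → Set
IsStrictlyUpper f = ∀ i j → does (i Fin.<? j) ≡ false → entry f i j ≡ 0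

inflow-zero : ∀ {m} (f : Mat (suc m)) → inflow f zero ≡ + 0
inflow-zero {m} f = trans (sumℤ-cong {suc m} _ (λ _ → + 0) (λ _ → refl)) (sumℤ-zero (suc m))

net : ∀ {m} → Mat m → Fin m → ℤ
net f i = outflow f i -ℤ inflow f i

extend : ∀ {n} → Vec ℕ (suc n) → Mat (suc n) → Mat (suc (suc n))
extend c g = (0 ∷ c) ∷ Vec.map (0 ∷_) g

module _ {n} (c : Vec ℕ (suc n)) (g : Mat (suc n)) where

  entry-extend-suc-suc : ∀ i j → entry (extend c g) (suc i) (suc j) ≡ entry g i j
  entry-extend-suc-suc i j = cong (λ row → lookup row (suc j)) (lookup-map i (0 ∷_) g)

  entry-extend-suc-zero : ∀ i → entry (extend c g) (suc i) zero ≡ 0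
  entry-extend-suc-zero i = cong (λ row → lookup row zero) (lookup-map i (0 ∷_) g)

  extend-strictlyUpper⁺ : IsStrictlyUpper g → IsStrictlyUpper (extend c g)
  extend-strictlyUpper⁺ g-up zero    zero    _    = refl
  extend-strictlyUpper⁺ g-up (suc i) zero    _    = entry-extend-suc-zero i
  extend-strictlyUpper⁺ g-up (suc i) (suc j) i≮j = trans (entry-extend-suc-suc i j) (g-up i j i≮j)

  extend-strictlyUpper⁻ : IsStrictlyUpper (extend c g) → IsStrictlyUpper g
  extend-strictlyUpper⁻ f-up i j i≮j = trans (sym (entry-extend-suc-suc i j)) (f-up (suc i) (suc j) i≮j)

  net-extend-zero : net (extend c g) zero ≡ + Vec.sum c
  net-extend-zero = begin
    (+ 0 +ℤ sumℤ (λ j → + lookup c j)) -ℤ inflow (extend c g) zero  ≡⟨ cong₂ _-ℤ_ (trans (ℤ.+-identityˡ _) (sumℤ-lookup c)) (inflow-zero (extend c g)) ⟩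
    + Vec.sum c -ℤ + 0                                                ≡⟨ ℤ.+-identityʳ (+ Vec.sum c) ⟩
    + Vec.sum c                                                       ∎
    where open ≡-Reasoning

  net-extend-suc : ∀ i → net (extend c g) (suc i) +ℤ + lookup c i ≡ net g i
  net-extend-suc i = begin
    (outflow (extend c g) (suc i) -ℤ inflow (extend c g) (suc i)) +ℤ + lookup c i
      ≡⟨ cong₂ (λ o ι → (o -ℤ ι) +ℤ + lookup c i) outflow-suc inflow-suc ⟩
    (outflow g i -ℤ (+ lookup c i +ℤ inflow g i)) +ℤ + lookup c i
      ≡⟨ cancel (outflow g i) (+ lookup c i) (inflow g i) ⟩
    outflow g i -ℤ inflow g i ∎
    where
    open ≡-Reasoning
    outflow-suc : outflow (extend c g) (suc i) ≡ outflow g i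
    outflow-suc = trans (ℤ.+-identityˡ _) (sumℤ-cong _ _ λ j →
      cong (λ x → if does (i Fin.<? j) then + x else + 0) (entry-extend-suc-suc i j))
    inflow-suc : inflow (extend c g) (suc i) ≡ + lookup c i +ℤ inflow g i
    inflow-suc = cong (+ lookup c i +ℤ_) (sumℤ-cong _ _ λ k → cong (λ x → if does (k Fin.<? i) then + x else + 0) (entry-extend-suc-suc k i))
    cancel : ∀ o x ι → (o -ℤ (x +ℤ ι)) +ℤ x ≡ o -ℤ ι
    cancel = solve-∀ℤ

extend-injective : ∀ {n} {c c′ : Vec ℕ (suc n)} {g g′} → extend c g ≡ extend c′ g′ → c ≡ c′ × g ≡ g′
extend-injective {g = g} {g′} eq = proj₂ (∷-injective (proj₁ (∷-injective eq))) , rows-injective g g′ (proj₂ (∷-injective eq))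
  where
  rows-injective : ∀ {k m} (g g′ : Vec (Vec ℕ m) k) → Vec.map (0 ∷_) g ≡ Vec.map (0 ∷_) g′ → g ≡ g′
  rows-injective []      []        _  = refl
  rows-injective (r ∷ g) (r′ ∷ g′) eq =
    cong₂ _∷_ (proj₂ (∷-injective (proj₁ (∷-injective eq)))) (rows-injective g g′ (proj₂ (∷-injective eq)))

strictlyUpper⇒extend : ∀ {n} (f : Mat (suc (suc n))) → IsStrictlyUpper f → ∃ λ c → ∃ λ g → f ≡ extend c g
strictlyUpper⇒extend ((x ∷ c) ∷ rows) f-up =
  c , Vec.map Vec.tail rows , cong₂ _∷_ (cong (_∷ c) (f-up zero zero refl)) (first-column-zero rows (λ i → f-up (suc i) zero refl))
  where
  first-column-zero : ∀ {k m} (rows : Vec (Vec ℕ (suc m)) k) → (∀ i → lookup (lookup rows i) zero ≡ 0) →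
    rows ≡ Vec.map (0 ∷_) (Vec.map Vec.tail rows)
  first-column-zero []               _    = refl
  first-column-zero ((y ∷ r) ∷ rows) y≡0 = cong₂ _∷_ (cong (_∷ r) (y≡0 zero)) (first-column-zero rows (λ i → y≡0 (suc i)))

withSink : ∀ {n} → Vec ℕ n → ℤ → Fin (suc n) → ℤ
withSink []       s zero    = s
withSink (a ∷ as) s zero    = + a
withSink (a ∷ as) s (suc i) = withSink as s i

supply : ∀ {n} → Vec ℕ n → Fin (suc n) → ℤ
supply a = withSink a (- + Vec.sum a)

withSink-shift : ∀ {m} (as : Vec ℕ m) s (c : Vec ℕ (suc m)) i →
  withSink as s i +ℤ + lookup c i ≡ withSink (zipWith _+_ as (Vec.init c)) (s +ℤ + Vec.last c) i
withSink-shift []       s (x ∷ [])    zero    = refl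
withSink-shift (a ∷ as) s (x ∷ y ∷ c) zero    = refl
withSink-shift (a ∷ as) s (x ∷ y ∷ c) (suc i) = withSink-shift as s (y ∷ c) i

supply-shift : ∀ {m} a (as : Vec ℕ m) (c : Vec ℕ (suc m)) → Vec.sum c ≡ a → ∀ i →
  supply (a ∷ as) (suc i) +ℤ + lookup c i ≡ supply (zipWith _+_ as (Vec.init c)) i
supply-shift a as c total i = trans (withSink-shift as _ c i) (cong (λ s → withSink (zipWith _+_ as (Vec.init c)) s i) sink)
  where
  open ≡-Reasoning
  S = Vec.sum as
  I = Vec.sum (Vec.init c)
  l = Vec.last c
  regroup : ∀ I l S → - ((I +ℤ l) +ℤ S) +ℤ l ≡ - (S +ℤ I)
  regroup = solve-∀ℤ
  sink : - + (a + S) +ℤ + l ≡ - + Vec.sum (zipWith _+_ as (Vec.init c))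
  sink = begin
    - + (a + S) +ℤ + l                ≡⟨ cong (λ x → - + (x + S) +ℤ + l) (trans (sum-init+last c) total) ⟨
    - + (I + l + S) +ℤ + l            ≡⟨ cong (λ x → - x +ℤ + l) (trans (ℤ.pos-+ (I + l) S) (cong (_+ℤ + S) (ℤ.pos-+ I l))) ⟩
    - ((+ I +ℤ + l) +ℤ + S) +ℤ + l    ≡⟨ regroup (+ I) (+ l) (+ S) ⟩
    - (+ S +ℤ + I)                    ≡⟨ cong -_ (trans (cong +_ (sum-zipWith-+ as (Vec.init c))) (ℤ.pos-+ S I)) ⟨
    - + Vec.sum (zipWith _+_ as (Vec.init c)) ∎

flows : ∀ {n} → Vec ℕ n → List (Mat (suc n))
flows []                = ((0 ∷ []) ∷ []) ∷ []
flows {suc n} (a ∷ as) = concatMap (λ c → map (extend c) (flows (zipWith _+_ as (Vec.init c)))) (compositions a n)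

length-flows : ∀ {n} (a : Vec ℕ n) → length (flows a) ≡ weightedCount a (λ _ → 1)
length-flows []                = refl
length-flows {suc n} (a ∷ as) = trans (length-concatMap _ (compositions a n)) (sum-map-cong _ _ (compositions a n) λ c →
  trans (length-map (extend c) (flows (zipWith _+_ as (Vec.init c)))) (length-flows (zipWith _+_ as (Vec.init c))))

flows-sound : ∀ {n} (a : Vec ℕ n) {f} → f ∈ flows a → IsFlow n (supply a) f
flows-sound [] (here refl) = (λ { zero zero _ → refl }) , (λ { zero → refl })
flows-sound {suc n} (a ∷ as) f∈ with find (∈-concatMap⁻ _ {xs = compositions a n} f∈)
... | c , c∈ , f∈′ with ∈-map⁻ (extend c) f∈′
... | g , g∈ , refl with flows-sound (zipWith _+_ as (Vec.init c)) g∈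
... | g-up , g-net = extend-strictlyUpper⁺ c g g-up , λ where
  zero    → trans (net-extend-zero c g) (cong +_ (∈-compositions⁻ a n c∈))
  (suc i) → ∙-cancelʳ (+ lookup c i) _ _
              (trans (net-extend-suc c g i) (trans (g-net i) (sym (supply-shift a as c (∈-compositions⁻ a n c∈) i))))

flows-complete : ∀ {n} (a : Vec ℕ n) {f} → IsFlow n (supply a) f → f ∈ flows a
flows-complete [] {(x ∷ []) ∷ []} (f-up , _) with refl ← f-up zero zero refl = here refl
flows-complete {suc n} (a ∷ as) {f} (f-up , f-net) with c , g , refl ← strictlyUpper⇒extend f f-up =
  ∈-concatMap⁺ _ (lose c∈ (∈-map⁺ (extend c) (flows-complete (zipWith _+_ as (Vec.init c)) (extend-strictlyUpper⁻ c g f-up , g-net))))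
  where
  total : Vec.sum c ≡ a
  total = ℤ.+-injective (trans (sym (net-extend-zero c g)) (f-net zero))
  c∈ : c ∈ compositions a n
  c∈ = subst (λ b → c ∈ compositions b n) total (∈-compositions⁺ n c)
  g-net : ∀ i → net g i ≡ supply (zipWith _+_ as (Vec.init c)) i
  g-net i = trans (sym (net-extend-suc c g i)) (trans (cong (_+ℤ + lookup c i) (f-net (suc i))) (supply-shift a as c total i))

flows-unique : ∀ {n} (a : Vec ℕ n) → Unique (flows a)
flows-unique []                = [] ∷ []
flows-unique {suc n} (a ∷ as) = concatMap-unique _ (compositions-unique a n)
  (λ c → map⁺ (λ eq → proj₂ (extend-injective eq)) (flows-unique (zipWith _+_ as (Vec.init c)))) disjoint
  where
  disjoint : ∀ {c c′ v} → v ∈ map (extend c) (flows (zipWith _+_ as (Vec.init c))) →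
             v ∈ map (extend c′) (flows (zipWith _+_ as (Vec.init c′))) → c ≡ c′
  disjoint v∈ v∈′ with ∈-map⁻ _ v∈ | ∈-map⁻ _ v∈′
  ... | _ , _ , refl | _ , _ , eq = proj₁ (extend-injective eq)

Nvec≡supply : ∀ n t i → Nvec n t i ≡ supply (replicate n t) i
Nvec≡supply n t i = trans (withSink-replicate n (- + (n * t)) i) (cong (λ x → withSink (replicate n t) (- + x) i) (sym (sum-replicate n t)))
  where
  withSink-replicate : ∀ n s i → (if does (i Fin.≟ Fin.fromℕ n) then s else + t) ≡ withSink (replicate n t) s i
  withSink-replicate zero    s zero    = refl
  withSink-replicate (suc n) s zero    = refl
  withSink-replicate (suc n) s (suc i) = withSink-replicate n s i

IsFlow-resp : ∀ {n N N′ f} → (∀ i → N i ≡ N′ i) → IsFlow n N f → IsFlow n N′ f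
IsFlow-resp N≗N′ (f-up , f-net) = f-up , λ i → trans (f-net i) (N≗N′ i)

proposition2p17 : (n t : ℕ) → 1 ≤ n →
    Σ ℕ (λ k → KnIs n (Nvec n t) k × (k ≤ (t + 1) ^ (n C 2)) × (lowerProd n t ≤ k))
proposition2p17 n t _ = K n t , counted , upper , K-≥ n t
  where
  a = replicate n t
  counted : KnIs n (Nvec n t) (K n t)
  counted = flows a , flows-unique a ,
    (λ f → mk⇔ (λ f∈ → IsFlow-resp {f = f} (λ i → sym (Nvec≡supply n t i)) (flows-sound a f∈))
               (λ f-flow → flows-complete a (IsFlow-resp {f = f} (Nvec≡supply n t) f-flow))) ,
    length-flows a
  upper : K n t ≤ (t + 1) ^ (n C 2)
  upper = subst (λ x → K n t ≤ x ^ (n C 2)) (+-comm 1 t) (K-≤ n t)
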